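{- Let $P\subset\mathbb{R}^2$ be a finite point set with distinct $x$-coordinates and distinct $y$-coordinates. Every point $p\in\mathrm{add}_{\uparrow}(P)$ satisfies at least one of the following: (a) $p$ is the rightmost point of $\mathrm{add}_{\uparrow}(P)$ with $y$-coordinate $p.y$; (b) $p$ is the highest point of $\mathrm{add}_{\uparrow}(P)$ with $x$-coordinate $p.x$; (c) letting $r$ be the lowest point of $\mathrm{add}_{\uparrow}(P)$ with $r.x=p.x$ and $r.y>p.y$, the point $r$ exists and there is $d\in P$ with $d.y=r.y$ such that $d$ is the first entry of some z-rectangle $(d,\cdot,\cdot,\cdot)$ of $P$.
   Context: For a point $p$, $p.x,p.y$ are its coordinates. $\mathrm{rect}(p,q)$ is the smallest closed axis-aligned rectangle containing $p,q$. A z-rectangle of $P$ is a tuple $(p,q,r,s)\in P^4$ with $q.x<p.x<r.x<s.x$, $r.y<q.y<s.y<p.y$, and $P\cap([q.x,s.x]\times[r.y,p.y])=\{p,q,r,s\}$. $\mathrm{add}_{\uparrow}(P)$: sweep a horizontal line upward over the points of $P$ in increasing $y$-coordinate, maintaining a set $Q$ which initially is $P$. When the sweep reaches the point $p\in P$, for every point $q$ of $Q$ (as it stands when $p$ is reached, i.e. $P$ together with all points added at earlier sweep positions) with $q.x<p.x$, $q.y<p.y$ and $Q\cap\mathrm{rect}(p,q)=\{p,q\}$, add the upper-left corner $(q.x,p.y)$ of $\mathrm{rect}(p,q)$ to $Q$. $\mathrm{add}_{\uparrow}(P)$ is the set of all added points (excluding points originally in $P$).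
   Formalization: The points of P have rational coordinates, so P is a finite subset of ℚ² instead of ℝ². -}

module Defs where

open import Data.Rational using (ℚ; _<_; _≤_)
open import Data.Rational.Properties using (_<?_; _≤?_; _≟_)
open import Data.Product using (_×_; _,_; proj₁; proj₂; ∃-syntax)
open import Data.Product.Properties using (≡-dec)
open import Data.Sum using (_⊎_)
open import Data.List using (List; []; _∷_; _++_; filter; map; foldl)
open import Data.List.Relation.Unary.All using (All; all?)
open import Data.List.Membership.Propositional using (_∈_)
open import Relation.Nullary using (Dec; yes; no; ¬_)
open import Relation.Nullary.Decidable using (_×-dec_; _⊎-dec_; _→-dec_)
open import Relation.Binary.PropositionalEquality using (_≡_)

Pt : Set
Pt = ℚ × ℚ

X : Pt → ℚ
X = proj₁

Y : Pt → ℚ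
Y = proj₂

_≟P_ : (a b : Pt) → Dec (a ≡ b)
_≟P_ = ≡-dec _≟_ _≟_

-- s lies in the closed rectangle rect(p,q) (smallest closed axis-aligned
-- rectangle containing p and q), for the case q.x < p.x, q.y < p.y used below.
InRect : Pt → Pt → Pt → Set
InRect p q s = (X q ≤ X s × X s ≤ X p) × (Y q ≤ Y s × Y s ≤ Y p)

inRect? : (p q s : Pt) → Dec (InRect p q s)
inRect? p q s = ((X q ≤? X s) ×-dec (X s ≤? X p)) ×-dec ((Y q ≤? Y s) ×-dec (Y s ≤? Y p))

Visible : List Pt → Pt → Pt → Set
Visible Q p q = (X q < X p × Y q < Y p) ×
                All (λ s → InRect p q s → (s ≡ p ⊎ s ≡ q)) Q

visible? : (Q : List Pt) (p q : Pt) → Dec (Visible Q p q)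
visible? Q p q = ((X q <? X p) ×-dec (Y q <? Y p)) ×-dec
                 all? (λ s → inRect? p q s →-dec ((s ≟P p) ⊎-dec (s ≟P q))) Q

corner : Pt → Pt → Pt
corner p q = (X q , Y p)

addedAt : List Pt → Pt → List Pt
addedAt Q p = map (corner p) (filter (visible? Q p) Q)

insertY : Pt → List Pt → List Pt
insertY p [] = p ∷ []
insertY p (q ∷ qs) with Y p ≤? Y q
... | yes _ = p ∷ q ∷ qs
... | no  _ = q ∷ insertY p qs

sortY : List Pt → List Pt
sortY []       = []
sortY (p ∷ ps) = insertY p (sortY ps)

-- The sweep: state = (Q , added points so far).
sweepStep : List Pt × List Pt → Pt → List Pt × List Pt
sweepStep (Q , A) p = (Q ++ addedAt Q p , A ++ addedAt Q p)

addUp : List Pt → List Pt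
addUp P = proj₂ (foldl sweepStep (P , []) (sortY P))

ZRect : List Pt → Pt → Pt → Pt → Pt → Set
ZRect P p q r s =
  (p ∈ P × q ∈ P × r ∈ P × s ∈ P) ×
  (X q < X p × X p < X r × X r < X s) ×
  (Y r < Y q × Y q < Y s × Y s < Y p) ×
  (∀ t → t ∈ P → (X q ≤ X t × X t ≤ X s) → (Y r ≤ Y t × Y t ≤ Y p) →
     (t ≡ p ⊎ t ≡ q ⊎ t ≡ r ⊎ t ≡ s))

{-# OPTIONS --safe #-}
module Submission where

-- The sweep keeps every added point w anchored: some e ∈ P lies right of w on its row (the point
-- whose sweep step added w), some o ∈ P lies on or below w on its column, and no point of P strictly
-- between w and e horizontally has height in [o.y, w.y).
-- Let c be an added point with an added point c′ to its right on its row, and let r be the lowest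
-- added point above c on its column. r was added when the sweep reached some d ∈ P, and d must
-- have seen c itself. A z-rectangle (d, q, r′, s) is then chosen greedily: s is the leftmost point
-- of P right of d with height in [c.y, d.y), r′ the highest point of P below d strictly between d
-- and s, and q the rightmost point of P left of d with height in (r′.y, d.y). The point r′ exists
-- because either s is the point of P on c's row, and the column of c′ supplies a candidate, or s
-- would see c and add a point strictly between c and r; the anchoring of c makes q exist.

open import Defs
open import Data.Rational using (ℚ; _<_; _≤_; _≥_)
open import Data.Rational.Properties
  using (≤-refl; ≤-reflexive; ≤-trans; ≤-antisym; ≤-total; <⇒≤; <⇒≢; <-irrefl; <-asym; <-trans;
         ≤-<-trans; <-≤-trans; <-cmp; ≰⇒>; ≮⇒≥; ≤-decTotalOrder)
  renaming (_≤?_ to _≤ℚ?_; _<?_ to _<ℚ?_; _≟_ to _≟ℚ_)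
open import Data.Product using (_×_; _,_; ∃-syntax; proj₂)
open import Data.Sum using (_⊎_; inj₁; inj₂; [_,_]′)
open import Data.Empty using (⊥; ⊥-elim)
open import Data.List using (List; []; _∷_; _++_; map; foldl)
open import Data.List.Properties using (++-assoc; ++-identityʳ)
open import Data.List.Membership.Propositional using (_∈_; lose; find)
open import Data.List.Membership.Propositional.Properties
  using (∈-map⁺; ∈-map⁻; ∈-++⁺ˡ; ∈-++⁺ʳ; ∈-++⁻; ∈-filter⁺; ∈-filter⁻)
open import Data.List.Relation.Binary.Subset.Propositional using (_⊆_)
open import Data.List.Relation.Binary.Permutation.Propositional using (↭-sym; ↭⇒↭ₛ)
import Data.List.Relation.Binary.Permutation.Propositional.Properties as ↭
import Data.List.Relation.Binary.Permutation.Setoid.Properties as ↭ₛ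
open import Data.List.Relation.Unary.Any using (here; there; any?)
open import Data.List.Relation.Unary.All as All using (All; []; _∷_)
open import Data.List.Relation.Unary.AllPairs as AllPairs using (AllPairs; []; _∷_)
import Data.List.Relation.Unary.AllPairs.Properties as AllPairs
open import Data.List.Relation.Unary.Sorted.TotalOrder.Properties using (Sorted⇒AllPairs)
open import Data.List.Relation.Unary.Unique.Propositional using (Unique)
open import Function using (_∘_; _on_; flip; id)
open import Relation.Binary.Bundles using (DecTotalOrder)
open import Relation.Binary.Definitions using (Total; Transitive; tri<; tri≈; tri>)
import Relation.Binary.Construct.On as On
open import Relation.Binary.PropositionalEquality
  using (_≡_; _≢_; refl; sym; trans; cong; subst; subst₂; ≢-sym; setoid)
open import Relation.Nullary using (¬_; yes; no)
open import Relation.Nullary.Decidable using (_×-dec_; dec-true; dec-false)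
open import Relation.Unary using (Decidable)

≤∧≢⇒< : ∀ {a b : ℚ} → a ≤ b → a ≢ b → a < b
≤∧≢⇒< {a} {b} a≤b a≢b with <-cmp a b
... | tri< a<b _ _ = a<b
... | tri≈ _ a≡b _ = ⊥-elim (a≢b a≡b)
... | tri> _ _ b<a = ⊥-elim (<-irrefl refl (<-≤-trans b<a a≤b))

≤⇒≡⊎< : ∀ {a b : ℚ} → a ≤ b → a ≡ b ⊎ a < b
≤⇒≡⊎< {a} {b} a≤b with a ≟ℚ b
... | yes a≡b = inj₁ a≡b
... | no a≢b = inj₂ (≤∧≢⇒< a≤b a≢b)

<⇒≱ : ∀ {a b : ℚ} → a < b → ¬ b ≤ a
<⇒≱ a<b b≤a = <-irrefl refl (<-≤-trans a<b b≤a)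

X<⇒≢ : ∀ {a b : Pt} → X a < X b → a ≢ b
X<⇒≢ a<b = <⇒≢ a<b ∘ cong X

Y<⇒≢ : ∀ {a b : Pt} → Y a < Y b → a ≢ b
Y<⇒≢ a<b = <⇒≢ a<b ∘ cong Y

Unique-map⇒injective : ∀ {A B : Set} (f : A → B) {xs : List A} → Unique (map f xs) →
                        ∀ {a b} → a ∈ xs → b ∈ xs → f a ≡ f b → a ≡ b
Unique-map⇒injective f {_ ∷ _} _ (here refl) (here refl) _ = refl
Unique-map⇒injective f {_ ∷ _} (fx∉ ∷ _) (here refl) (there b∈) fa≡fb =
  ⊥-elim (All.lookup fx∉ (∈-map⁺ f b∈) fa≡fb)
Unique-map⇒injective f {_ ∷ _} (fx∉ ∷ _) (there a∈) (here refl) fa≡fb =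
  ⊥-elim (All.lookup fx∉ (∈-map⁺ f a∈) (sym fa≡fb))
Unique-map⇒injective f {_ ∷ _} (_ ∷ unique) (there a∈) (there b∈) fa≡fb =
  Unique-map⇒injective f unique a∈ b∈ fa≡fb

LeastOrNone : {A : Set} → (A → A → Set) → (A → Set) → List A → Set
LeastOrNone _≼_ P xs =
  (∀ {t} → t ∈ xs → ¬ P t) ⊎ ∃[ m ] (m ∈ xs × P m × ∀ {t} → t ∈ xs → P t → m ≼ t)

module _ {A : Set} {_≼_ : A → A → Set} (total : Total _≼_) (≼-trans : Transitive _≼_) where

  private
    head-least : ∀ {P : A → Set} {x xs} →
                 (∀ {t} → t ∈ xs → P t → x ≼ t) → ∀ {t} → t ∈ x ∷ xs → P t → x ≼ t
    head-least {x = x} _ (here refl) _ = [ id , id ]′ (total x x)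
    head-least x≼xs (there t∈) = x≼xs t∈

  least : {P : A → Set} → Decidable P → (xs : List A) → LeastOrNone _≼_ P xs
  least P? [] = inj₁ λ ()
  least P? (x ∷ xs) with P? x | least P? xs
  ... | no ¬Px | inj₁ none = inj₁ λ { (here refl) → ¬Px ; (there t∈) → none t∈ }
  ... | no ¬Px | inj₂ (m , m∈ , Pm , m≼) =
    inj₂ (m , there m∈ , Pm , λ { (here refl) Px → ⊥-elim (¬Px Px) ; (there t∈) → m≼ t∈ })
  ... | yes Px | inj₁ none = inj₂ (x , here refl , Px , head-least λ t∈ Pt → ⊥-elim (none t∈ Pt))
  ... | yes Px | inj₂ (m , m∈ , Pm , m≼) with total x m
  ...   | inj₁ x≼m = inj₂ (x , here refl , Px , head-least λ t∈ Pt → ≼-trans x≼m (m≼ t∈ Pt))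
  ...   | inj₂ m≼x = inj₂ (m , there m∈ , Pm , λ { (here refl) _ → m≼x ; (there t∈) → m≼ t∈ })

leftmost : {P : Pt → Set} → Decidable P → (xs : List Pt) → LeastOrNone (_≤_ on X) P xs
leftmost = least (λ a b → ≤-total (X a) (X b)) ≤-trans

rightmost : {P : Pt → Set} → Decidable P → (xs : List Pt) → LeastOrNone (_≥_ on X) P xs
rightmost = least (λ a b → ≤-total (X b) (X a)) (flip ≤-trans)

lowest : {P : Pt → Set} → Decidable P → (xs : List Pt) → LeastOrNone (_≤_ on Y) P xs
lowest = least (λ a b → ≤-total (Y a) (Y b)) ≤-trans

highest : {P : Pt → Set} → Decidable P → (xs : List Pt) → LeastOrNone (_≥_ on Y) P xs
highest = least (λ a b → ≤-total (Y b) (Y a)) (flip ≤-trans)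

byY : DecTotalOrder _ _ _
byY = On.decTotalOrder ≤-decTotalOrder Y

open import Data.List.Sort.InsertionSort byY using (insert; sort)
open import Data.List.Sort.InsertionSort.Properties byY using (sort-↭; sort-↗)

insertY≡insert : ∀ p qs → insertY p qs ≡ insert p qs
insertY≡insert p [] = refl
insertY≡insert p (q ∷ qs) with Y p ≤ℚ? Y q
... | yes p≤q rewrite dec-true (Y p ≤ℚ? Y q) p≤q = refl
... | no p≰q rewrite dec-false (Y p ≤ℚ? Y q) p≰q = cong (q ∷_) (insertY≡insert p qs)

sortY≡sort : ∀ ps → sortY ps ≡ sort ps
sortY≡sort [] = refl
sortY≡sort (p ∷ ps) rewrite sortY≡sort ps = insertY≡insert p (sort ps)

∈-sortY⁻ : ∀ {ps p} → p ∈ sortY ps → p ∈ ps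
∈-sortY⁻ {ps} rewrite sortY≡sort ps = ↭.∈-resp-↭ (sort-↭ ps)

∈-sortY⁺ : ∀ {ps p} → p ∈ ps → p ∈ sortY ps
∈-sortY⁺ {ps} rewrite sortY≡sort ps = ↭.∈-resp-↭ (↭-sym (sort-↭ ps))

sortY-ascending : ∀ {ps} → Unique (map Y ps) → AllPairs (_<_ on Y) (sortY ps)
sortY-ascending {ps} unique rewrite sortY≡sort ps =
  AllPairs.zipWith (λ (a≤b , a≢b) → ≤∧≢⇒< a≤b a≢b)
    ( Sorted⇒AllPairs (DecTotalOrder.totalOrder byY) (sort-↗ ps)
    , AllPairs.map⁻ (↭ₛ.Unique-resp-↭ (setoid ℚ) (↭⇒↭ₛ (↭.map⁺ Y (↭-sym (sort-↭ ps)))) unique)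
    )

∈-addedAt⁻ : ∀ {Q g w} → w ∈ addedAt Q g → ∃[ h ] (h ∈ Q × Visible Q g h × w ≡ corner g h)
∈-addedAt⁻ {Q} {g} w∈ with ∈-map⁻ (corner g) w∈
... | h , h∈ , refl with ∈-filter⁻ (visible? Q g) h∈
...   | h∈Q , visible = h , h∈Q , visible , refl

∈-addedAt⁺ : ∀ {Q g h} → h ∈ Q → Visible Q g h → corner g h ∈ addedAt Q g
∈-addedAt⁺ {Q} {g} h∈ visible = ∈-map⁺ (corner g) (∈-filter⁺ (visible? Q g) h∈ visible)

Y-addedAt : ∀ {Q g w} → w ∈ addedAt Q g → Y w ≡ Y g
Y-addedAt {Q} {g} w∈ with ∈-addedAt⁻ {Q} {g} w∈
... | _ , _ , _ , refl = refl

visible-below : ∀ {Q g h u} → Visible Q g h → u ∈ Q → X h < X u → X u < X g → Y u < Y g → Y u < Y h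
visible-below ((_ , _) , empty) u∈ h<u u<g u↓g =
  ≰⇒> λ h≤u → [ X<⇒≢ u<g , ≢-sym (X<⇒≢ h<u) ]′
                 (All.lookup empty u∈ ((<⇒≤ h<u , <⇒≤ u<g) , (h≤u , <⇒≤ u↓g)))

record Anchored (P : List Pt) (w : Pt) : Set where
  constructor anchored
  field
    east        : Pt
    east∈P      : east ∈ P
    east-row    : Y east ≡ Y w
    east-right  : X w < X east
    south       : Pt
    south∈P     : south ∈ P
    south-col   : X south ≡ X w
    south-below : Y south ≤ Y w
    gap         : ∀ {u} → u ∈ P → X w < X u → X u < X east → Y u < Y w → Y u < Y south

module _ (P : List Pt) where

  -- The sweep set Q at the moment the sweep reaches g, described through the final output 𝒜:
  -- every point added at or after g lies at height ≥ g.y.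
  Present : List Pt → Pt → Pt → Set
  Present 𝒜 g s = s ∈ P ⊎ (s ∈ 𝒜 × Y s < Y g)

  Sees : List Pt → Pt → Pt → Set
  Sees 𝒜 g h = (X h < X g × Y h < Y g) × (∀ {s} → Present 𝒜 g s → InRect g h s → s ≡ g ⊎ s ≡ h)

  Generated : List Pt → List Pt → Pt → Set
  Generated 𝒜 gs w = ∃[ g ] ∃[ h ] (g ∈ gs × Present 𝒜 g h × Sees 𝒜 g h × w ≡ corner g h)

  Below : List Pt → List Pt → Set
  Below A gs = ∀ {a g} → a ∈ A → g ∈ gs → Y a < Y g

  present-mono : ∀ {𝒜 g g′ s} → Y g ≤ Y g′ → Present 𝒜 g s → Present 𝒜 g′ s
  present-mono _ (inj₁ s∈P) = inj₁ s∈P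
  present-mono g≤g′ (inj₂ (s∈ , s↓g)) = inj₂ (s∈ , <-≤-trans s↓g g≤g′)

  next : List Pt → Pt → List Pt
  next A g = A ++ addedAt (P ++ A) g

  run : List Pt → List Pt → List Pt
  run A [] = A
  run A (g ∷ gs) = run (next A g) gs

  foldl-sweepStep≡run : ∀ A gs → foldl sweepStep (P ++ A , A) gs ≡ (P ++ run A gs , run A gs)
  foldl-sweepStep≡run A [] = refl
  foldl-sweepStep≡run A (g ∷ gs) rewrite ++-assoc P A (addedAt (P ++ A) g) = foldl-sweepStep≡run (next A g) gs

  addUp≡run : addUp P ≡ run [] (sortY P)
  addUp≡run = trans (cong (λ Q → proj₂ (foldl sweepStep (Q , []) (sortY P))) (sym (++-identityʳ P)))
                    (cong proj₂ (foldl-sweepStep≡run [] (sortY P)))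

  run-⊇ : ∀ A gs → A ⊆ run A gs
  run-⊇ A [] = id
  run-⊇ A (g ∷ gs) = run-⊇ (next A g) gs ∘ ∈-++⁺ˡ

  corner-anchored : ∀ {A g h} → (∀ {a} → a ∈ A → Anchored P a) →
                    g ∈ P → h ∈ P ++ A → Visible (P ++ A) g h → Anchored P (corner g h)
  corner-anchored {A} {g} {h} A-anchored g∈P h∈ visible@((h<g , h↓g) , empty) with ∈-++⁻ P h∈
  ... | inj₁ h∈P =
    anchored g g∈P refl h<g h h∈P refl (<⇒≤ h↓g) (λ u∈ → visible-below visible (∈-++⁺ˡ u∈))
  ... | inj₂ h∈A =
    anchored g g∈P refl h<g south south∈P south-col (≤-trans south-below (<⇒≤ h↓g))
      (λ u∈ h<u u<g u↓g →
         gap u∈ h<u (<-trans u<g g<east) (visible-below visible (∈-++⁺ˡ u∈) h<u u<g u↓g))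
    where
    open Anchored (A-anchored h∈A)
    g<east : X g < X east
    g<east = ≰⇒> λ east≤g →
      [ Y<⇒≢ (subst (_< Y g) (sym east-row) h↓g) , ≢-sym (X<⇒≢ east-right) ]′
        (All.lookup empty (∈-++⁺ˡ east∈P)
          ( (<⇒≤ east-right , east≤g)
          , (≤-reflexive (sym east-row) , ≤-trans (≤-reflexive east-row) (<⇒≤ h↓g)) ))

  run-anchored : ∀ A gs → gs ⊆ P → (∀ {a} → a ∈ A → Anchored P a) →
                 ∀ {w} → w ∈ run A gs → Anchored P w
  run-anchored A [] _ A-anchored = A-anchored
  run-anchored A (g ∷ gs) g∷gs⊆P A-anchored = run-anchored (next A g) gs (g∷gs⊆P ∘ there) next-anchored
    where
    next-anchored : ∀ {a} → a ∈ next A g → Anchored P a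
    next-anchored a∈ with ∈-++⁻ A a∈
    ... | inj₁ a∈A = A-anchored a∈A
    ... | inj₂ a∈new with ∈-addedAt⁻ a∈new
    ...   | h , h∈ , visible , refl = corner-anchored A-anchored (g∷gs⊆P (here refl)) h∈ visible

  Sound : List Pt → List Pt → Set
  Sound A gs = ∀ {w} → w ∈ run A gs → w ∈ A ⊎ Generated (run A gs) gs w

  next-below : ∀ {A g gs} → All (λ g′ → Y g < Y g′) gs → Below A (g ∷ gs) → Below (next A g) gs
  next-below {A} {g} g<gs A<g∷gs a∈ g′∈ with ∈-++⁻ A a∈
  ... | inj₁ a∈A = A<g∷gs a∈A (there g′∈)
  ... | inj₂ a∈new = subst (_< _) (sym (Y-addedAt {P ++ A} a∈new)) (All.lookup g<gs g′∈)

  module SweepSetAt {A g gs} (A<g : ∀ {a} → a ∈ A → Y a < Y g) (g<gs : All (λ g′ → Y g < Y g′) gs)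
           (sound : Sound (next A g) gs) where

    present⁺ : ∀ {s} → s ∈ P ++ A → Present (run (next A g) gs) g s
    present⁺ s∈ with ∈-++⁻ P s∈
    ... | inj₁ s∈P = inj₁ s∈P
    ... | inj₂ s∈A = inj₂ (run-⊇ (next A g) gs (∈-++⁺ˡ s∈A) , A<g s∈A)

    present⁻ : ∀ {s} → Present (run (next A g) gs) g s → s ∈ P ++ A
    present⁻ (inj₁ s∈P) = ∈-++⁺ˡ s∈P
    present⁻ (inj₂ (s∈ , s↓g)) with sound s∈
    ... | inj₂ (g′ , _ , g′∈ , _ , _ , refl) = ⊥-elim (<-asym s↓g (All.lookup g<gs g′∈))
    ... | inj₁ s∈next with ∈-++⁻ A s∈next
    ...   | inj₁ s∈A = ∈-++⁺ʳ P s∈A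
    ...   | inj₂ s∈new = ⊥-elim (<-irrefl (Y-addedAt {P ++ A} s∈new) s↓g)

    visible⇒sees : ∀ {h} → Visible (P ++ A) g h → Sees (run (next A g) gs) g h
    visible⇒sees (h<g , empty) = h<g , λ s-present → All.lookup empty (present⁻ s-present)

    sees⇒visible : ∀ {h} → Sees (run (next A g) gs) g h → Visible (P ++ A) g h
    sees⇒visible (h<g , empty) = h<g , All.tabulate (empty ∘ present⁺)

  run-sound : ∀ A gs → AllPairs (_<_ on Y) gs → Below A gs → Sound A gs
  run-sound A [] _ _ w∈ = inj₁ w∈
  run-sound A (g ∷ gs) (g<gs ∷ ascending) A<g∷gs = extend
    where
    sound : Sound (next A g) gs
    sound = run-sound (next A g) gs ascending (next-below g<gs A<g∷gs)
    open SweepSetAt (λ a∈ → A<g∷gs a∈ (here refl)) g<gs sound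
    extend : Sound A (g ∷ gs)
    extend w∈ with sound w∈
    ... | inj₂ (g′ , h , g′∈ , generated) = inj₂ (g′ , h , there g′∈ , generated)
    ... | inj₁ w∈next with ∈-++⁻ A w∈next
    ...   | inj₁ w∈A = inj₁ w∈A
    ...   | inj₂ w∈new with ∈-addedAt⁻ w∈new
    ...     | h , h∈ , visible , refl = inj₂ (g , h , here refl , present⁺ h∈ , visible⇒sees visible , refl)

  run-complete : ∀ A gs → AllPairs (_<_ on Y) gs → Below A gs →
                 ∀ {g h} → g ∈ gs → Present (run A gs) g h → Sees (run A gs) g h → corner g h ∈ run A gs
  run-complete A (g ∷ gs) (g<gs ∷ ascending) A<g∷gs (here refl) h-present sees =
    run-⊇ (next A g) gs (∈-++⁺ʳ A (∈-addedAt⁺ (present⁻ h-present) (sees⇒visible sees)))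
    where
    open SweepSetAt (λ a∈ → A<g∷gs a∈ (here refl)) g<gs
                    (run-sound (next A g) gs ascending (next-below g<gs A<g∷gs))
  run-complete A (g ∷ gs) (g<gs ∷ ascending) A<g∷gs (there g∈) =
    run-complete (next A g) gs ascending (next-below g<gs A<g∷gs) g∈

  addUp-anchored : ∀ {w} → w ∈ addUp P → Anchored P w
  addUp-anchored rewrite addUp≡run = run-anchored [] (sortY P) ∈-sortY⁻ (λ ())

  present-south : ∀ {g t} → Present (addUp P) g t → ∃[ o ] (o ∈ P × X o ≡ X t × Y o ≤ Y t)
  present-south {t = t} (inj₁ t∈P) = t , t∈P , refl , ≤-refl
  present-south (inj₂ (t∈ , _)) = south , south∈P , south-col , south-below
    where open Anchored (addUp-anchored t∈)

  ColumnClear : Pt → Pt → Set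
  ColumnClear c d = ∀ {s} → s ∈ addUp P → X s ≡ X c → Y c < Y s → Y d ≤ Y s

  module _ (Y-unique : Unique (map Y P)) where

    addUp-sound : ∀ {w} → w ∈ addUp P →
                  ∃[ g ] ∃[ h ] (g ∈ P × Present (addUp P) g h × Sees (addUp P) g h × w ≡ corner g h)
    addUp-sound w∈ rewrite addUp≡run with run-sound [] (sortY P) (sortY-ascending Y-unique) (λ ()) w∈
    ... | inj₁ ()
    ... | inj₂ (g , h , g∈ , generated) = g , h , ∈-sortY⁻ g∈ , generated

    addUp-complete : ∀ {g h} → g ∈ P → Present (addUp P) g h → Sees (addUp P) g h → corner g h ∈ addUp P
    addUp-complete g∈ rewrite addUp≡run =
      run-complete [] (sortY P) (sortY-ascending Y-unique) (λ ()) (∈-sortY⁺ g∈)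

  module _ (X-unique : Unique (map X P)) (Y-unique : Unique (map Y P)) where

    private
      X-injective : ∀ {a b} → a ∈ P → b ∈ P → X a ≡ X b → a ≡ b
      X-injective = Unique-map⇒injective X X-unique

      Y-injective : ∀ {a b} → a ∈ P → b ∈ P → Y a ≡ Y b → a ≡ b
      Y-injective = Unique-map⇒injective Y Y-unique

    zRect-intro : ∀ {d s o ℓ} → d ∈ P → s ∈ P → o ∈ P →
      X o < X d → X d < X s → Y o ≤ ℓ → ℓ ≤ Y s → Y s < Y d →
      (∀ {t} → t ∈ P → X o ≤ X t → X t < X d → ℓ ≤ Y t → Y t < Y d → ⊥) →
      ¬ (∀ {u} → u ∈ P → ¬ (X d < X u × X u < X s × Y u < Y d)) →
      (∀ {u} → u ∈ P → X d < X u → X u < X s → Y u < Y d → Y u < Y o) →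
      ∃[ q ] ∃[ r ] ZRect P d q r s
    zRect-intro {d} {s} {o} {ℓ} d∈ s∈ o∈ o<d d<s o↓ℓ ℓ≤s s↓d band-empty occupied below-o
      with highest (λ t → (X d <ℚ? X t) ×-dec ((X t <ℚ? X s) ×-dec (Y t <ℚ? Y d))) P
    ... | inj₁ none = ⊥-elim (occupied none)
    ... | inj₂ (r , r∈ , (d<r , r<s , r↓d) , r-highest) =
      choose-q (rightmost (λ t → (X t <ℚ? X d) ×-dec ((Y r <ℚ? Y t) ×-dec (Y t <ℚ? Y d))) P)
      where
      o-candidate : X o < X d × Y r < Y o × Y o < Y d
      o-candidate = o<d , below-o r∈ d<r r<s r↓d , ≤-<-trans o↓ℓ (≤-<-trans ℓ≤s s↓d)

      choose-q : LeastOrNone (_≥_ on X) (λ t → X t < X d × Y r < Y t × Y t < Y d) P →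
                 ∃[ q ] ∃[ r′ ] ZRect P d q r′ s
      choose-q (inj₁ none) = ⊥-elim (none o∈ o-candidate)
      choose-q (inj₂ (q , q∈ , (q<d , r↓q , q↓d) , q-rightmost)) =
        q , r , (d∈ , q∈ , r∈ , s∈) , (q<d , d<r , r<s) , (r↓q , <-≤-trans q↓ℓ ℓ≤s , s↓d) , box
        where
        q↓ℓ : Y q < ℓ
        q↓ℓ = ≰⇒> λ ℓ≤q → band-empty q∈ (q-rightmost o∈ o-candidate) q<d ℓ≤q q↓d

        box : ∀ t → t ∈ P → (X q ≤ X t × X t ≤ X s) → (Y r ≤ Y t × Y t ≤ Y d) →
              t ≡ d ⊎ t ≡ q ⊎ t ≡ r ⊎ t ≡ s
        box t t∈ (q≤t , t≤s) (r≤t , t≤d) with ≤⇒≡⊎< t≤d | ≤⇒≡⊎< t≤s | <-cmp (X t) (X d)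
        ... | inj₁ t-row-d | _ | _ = inj₁ (Y-injective t∈ d∈ t-row-d)
        ... | inj₂ _ | inj₁ t-col-s | _ = inj₂ (inj₂ (inj₂ (X-injective t∈ s∈ t-col-s)))
        ... | inj₂ _ | inj₂ _ | tri≈ _ t-col-d _ = inj₁ (X-injective t∈ d∈ t-col-d)
        ... | inj₂ t↓d | inj₂ t<s | tri> _ _ d<t =
          inj₂ (inj₂ (inj₁ (Y-injective t∈ r∈ (≤-antisym (r-highest t∈ (d<t , t<s , t↓d)) r≤t))))
        ... | inj₂ t↓d | inj₂ _ | tri< t<d _ _ with ≤⇒≡⊎< r≤t
        ...   | inj₁ r-row-t = inj₂ (inj₂ (inj₁ (Y-injective t∈ r∈ (sym r-row-t))))
        ...   | inj₂ r↓t =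
          inj₂ (inj₁ (X-injective t∈ q∈ (≤-antisym (q-rightmost t∈ (t<d , r↓t , t↓d)) q≤t)))

    sees-shift-right : ∀ {d s c} → s ∈ P → Sees (addUp P) d c → X d < X s → Y c < Y s → Y s < Y d →
      (∀ {u} → u ∈ P → ¬ (X d < X u × X u < X s × Y u < Y d)) → Sees (addUp P) s c
    sees-shift-right {d} {s} {c} s∈ ((c<d , _) , d-empty) d<s c↓s s↓d nothing-between =
      (<-trans c<d d<s , c↓s) , s-empty
      where
      s-empty : ∀ {t} → Present (addUp P) s t → InRect s c t → t ≡ s ⊎ t ≡ c
      s-empty {t} t-present ((c≤t , t≤s) , (c≤ᵧt , t≤ᵧs))
        with X t ≤ℚ? X d | present-south {s} t-present
      ... | yes t≤d | _ =
        [ ⊥-elim ∘ Y<⇒≢ (≤-<-trans t≤ᵧs s↓d) , inj₂ ]′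
          (d-empty (present-mono {addUp P} {s} {d} (<⇒≤ s↓d) t-present)
                   ((c≤t , t≤d) , (c≤ᵧt , ≤-trans t≤ᵧs (<⇒≤ s↓d))))
      ... | no t≰d | o , o∈ , o-col , o≤t with ≤⇒≡⊎< (subst (_≤ X s) (sym o-col) t≤s)
      ...   | inj₂ o<s =
        ⊥-elim (nothing-between o∈
                  (subst (X d <_) (sym o-col) (≰⇒> t≰d) , o<s , ≤-<-trans o≤t (≤-<-trans t≤ᵧs s↓d)))
      ...   | inj₁ o-col-s with X-injective o∈ s∈ o-col-s | t-present
      ...     | refl | inj₁ t∈P = inj₁ (X-injective t∈P s∈ (sym o-col))
      ...     | refl | inj₂ (_ , t↓s) = ⊥-elim (<⇒≱ t↓s o≤t)

    column-clear⇒sees : ∀ {c d h} → c ∈ addUp P → Present (addUp P) d h → Sees (addUp P) d h →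
      X h ≡ X c → Y c < Y d → ColumnClear c d → Sees (addUp P) d c
    column-clear⇒sees {c} {d} {h} c∈ h-present d-sees-h@((h<d , _) , d-empty) h-col c↓d clear =
      subst (Sees (addUp P) d) (h≡c h-present) d-sees-h
      where
      open Anchored (addUp-anchored c∈)
      h≡c : Present (addUp P) d h → h ≡ c
      h≡c h-present with Y h ≤ℚ? Y c | h-present
      ... | yes h≤c | _ =
        [ ⊥-elim ∘ Y<⇒≢ c↓d , sym ]′
          (d-empty (inj₂ (c∈ , c↓d))
                   ((≤-reflexive h-col , subst (_≤ X d) h-col (<⇒≤ h<d)) , (h≤c , <⇒≤ c↓d)))
      ... | no h≰c | inj₁ h∈P =
        ⊥-elim (h≰c (subst (λ z → Y z ≤ Y c)
                           (X-injective south∈P h∈P (trans south-col (sym h-col))) south-below))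
      ... | no h≰c | inj₂ (h∈ , h↓d) = ⊥-elim (<⇒≱ h↓d (clear h∈ h-col (≰⇒> h≰c)))

    left-of-east : ∀ {c c′} (c∈ : c ∈ addUp P) → c′ ∈ addUp P → Y c′ ≡ Y c →
                   X c′ < X (Anchored.east (addUp-anchored c∈))
    left-of-east {c′ = c′} c∈ c′∈ c′-row = subst (λ e → X c′ < X e) same-east C′.east-right
      where
      module C = Anchored (addUp-anchored c∈)
      module C′ = Anchored (addUp-anchored c′∈)
      same-east : C′.east ≡ C.east
      same-east = Y-injective C′.east∈P C.east∈P (trans C′.east-row (trans c′-row (sym C.east-row)))

    zRect-above : ∀ {c c′ d} → c ∈ addUp P → c′ ∈ addUp P → Y c′ ≡ Y c → X c < X c′ →
      d ∈ P → Sees (addUp P) d c → ColumnClear c d →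
      ∃[ q ] ∃[ r ] ∃[ s ] ZRect P d q r s
    zRect-above {c} {c′} {d} c∈ c′∈ c′-row c<c′ d∈ d-sees-c@((c<d , c↓d) , d-empty) clear =
      choose-s (leftmost (λ t → (X d <ℚ? X t) ×-dec ((X t ≤ℚ? X p) ×-dec
                                 ((Y c ≤ℚ? Y t) ×-dec (Y t <ℚ? Y d)))) P)
      where
      open Anchored (addUp-anchored c∈) renaming (east to p; east∈P to p∈P; east-row to p-row)
      module C′ = Anchored (addUp-anchored c′∈)

      c′↓d : Y c′ < Y d
      c′↓d = subst (_< Y d) (sym c′-row) c↓d

      d<c′ : X d < X c′
      d<c′ = ≰⇒> λ c′≤d → [ Y<⇒≢ c′↓d , ≢-sym (X<⇒≢ c<c′) ]′
        (d-empty (inj₂ (c′∈ , c′↓d))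
                 ((<⇒≤ c<c′ , c′≤d) , (≤-reflexive (sym c′-row) , <⇒≤ c′↓d)))

      c′<p : X c′ < X p
      c′<p = left-of-east c∈ c′∈ c′-row

      d<p : X d < X p
      d<p = <-trans d<c′ c′<p

      band-empty : ∀ {t} → t ∈ P → X south ≤ X t → X t < X d → Y c ≤ Y t → Y t < Y d → ⊥
      band-empty {t} t∈ o≤t t<d c≤t t↓d =
        [ X<⇒≢ t<d , t≢c ]′
          (d-empty (inj₁ t∈) ((subst (_≤ X t) south-col o≤t , <⇒≤ t<d) , (c≤t , <⇒≤ t↓d)))
        where
        t≢c : t ≢ c
        t≢c t≡c =
          <-asym d<p (subst (λ z → X z < X d) (Y-injective t∈ p∈P (trans (cong Y t≡c) (sym p-row))) t<d)

      choose-s : LeastOrNone (_≤_ on X) (λ t → X d < X t × X t ≤ X p × Y c ≤ Y t × Y t < Y d) P →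
                 ∃[ q ] ∃[ r ] ∃[ s ] ZRect P d q r s
      choose-s (inj₁ none) =
        ⊥-elim (none p∈P (d<p , ≤-refl , ≤-reflexive (sym p-row) , subst (_< Y d) (sym p-row) c↓d))
      choose-s (inj₂ (s , s∈ , (d<s , s≤p , c≤s , s↓d) , s-leftmost)) =
        let q , r , z-rectangle = zRect-intro d∈ s∈ south∈P (subst (_< X d) (sym south-col) c<d) d<s
                                    south-below c≤s s↓d band-empty occupied below-south
        in q , r , s , z-rectangle
        where
        below-south : ∀ {u} → u ∈ P → X d < X u → X u < X s → Y u < Y d → Y u < Y south
        below-south {u} u∈ d<u u<s u↓d = gap u∈ (<-trans c<d d<u) (<-≤-trans u<s s≤p) u↓c
          where
          u↓c : Y u < Y c
          u↓c = ≰⇒> λ c≤u → <⇒≱ u<s (s-leftmost u∈ (d<u , ≤-trans (<⇒≤ u<s) s≤p , c≤u , u↓d))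

        occupied : ¬ (∀ {u} → u ∈ P → ¬ (X d < X u × X u < X s × Y u < Y d))
        occupied nothing-between with ≤⇒≡⊎< c≤s
        ... | inj₁ c-row-s =
          nothing-between C′.south∈P
            ( subst (X d <_) (sym C′.south-col) d<c′
            , subst₂ _<_ (sym C′.south-col) (cong X (sym s≡p)) c′<p
            , ≤-<-trans C′.south-below c′↓d )
          where
          s≡p : s ≡ p
          s≡p = Y-injective s∈ p∈P (trans (sym c-row-s) (sym p-row))
        ... | inj₂ c↓s =
          <⇒≱ s↓d (clear (addUp-complete Y-unique s∈ (inj₂ (c∈ , c↓s))
                              (sees-shift-right s∈ d-sees-c d<s c↓s s↓d nothing-between))
                          refl c↓s)

lemma32 : (P : List Pt) → Unique (map X P) → Unique (map Y P) →
  ∀ p → p ∈ addUp P →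
    -- (a) p is the rightmost point of add↑(P) with y-coordinate p.y
    (∀ s → s ∈ addUp P → Y s ≡ Y p → X s ≤ X p)
    -- (b) p is the highest point of add↑(P) with x-coordinate p.x
    ⊎ (∀ s → s ∈ addUp P → X s ≡ X p → Y s ≤ Y p)
    -- (c) the lowest point r of add↑(P) above p on the vertical line x = p.x
    --     exists, and some d ∈ P with d.y = r.y is the first entry of a z-rectangle of P
    ⊎ (∃[ r ] (r ∈ addUp P × X r ≡ X p × Y p < Y r ×
               (∀ s → s ∈ addUp P → X s ≡ X p → Y p < Y s → Y r ≤ Y s) ×
               ∃[ d ] (d ∈ P × Y d ≡ Y r ×
                       ∃[ q ] ∃[ r′ ] ∃[ s ] ZRect P d q r′ s)))
lemma32 P X-unique Y-unique c c∈
  with any? (λ s → (Y s ≟ℚ Y c) ×-dec (X c <ℚ? X s)) (addUp P)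
     | lowest (λ s → (X s ≟ℚ X c) ×-dec (Y c <ℚ? Y s)) (addUp P)
... | no ∄right | _ = inj₁ λ s s∈ s-row → ≮⇒≥ λ c<s → ∄right (lose s∈ (s-row , c<s))
... | yes _ | inj₁ ∄above = inj₂ (inj₁ λ s s∈ s-col → ≮⇒≥ λ c<s → ∄above s∈ (s-col , c<s))
... | yes ∃right | inj₂ (r , r∈ , (r-col , c↓r) , r-lowest)
  with find ∃right | addUp-sound P Y-unique r∈
...   | c′ , c′∈ , c′-row , c<c′ | d , h , d∈ , h-present , d-sees-h , refl =
  inj₂ (inj₂ (r , r∈ , r-col , c↓r , (λ s s∈ → clear s∈) , d , d∈ , refl ,
              zRect-above P X-unique Y-unique c∈ c′∈ c′-row c<c′ d∈ d-sees-c clear))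
  where
  clear : ColumnClear P c d
  clear s∈ s-col c↓s = r-lowest s∈ (s-col , c↓s)

  d-sees-c : Sees P (addUp P) d c
  d-sees-c = column-clear⇒sees P X-unique Y-unique c∈ h-present d-sees-h r-col c↓r clear
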